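{- Let $\beta$ be an integer with $1\le\beta\le4$, let $B,D$ be odd integers with $\gcd(B,D)=1$, and let $R$ be the smallest positive integer such that $DR\equiv 2^{4-\beta}B\pmod{16}$. Let $N$ be an integer with $1\le N\le 15$ and $N<R$. Then there are no rational numbers $x_1,\dots,x_N$ with $$x_1^4+x_2^4+\dots+x_N^4=\frac{B}{2^{\beta}D}.$$ -}

module Defs where

open import Data.Nat as ℕ using (ℕ)
import Data.Nat.Properties as ℕₚ
open import Data.Integer as ℤ using (ℤ; +_)
open import Data.Integer.Divisibility using (_∣_)
open import Data.Rational as ℚ using (ℚ)
open import Data.Fin using (Fin; zero; suc)
open import Data.Product using (∃; _×_)
open import Relation.Nullary using (¬_)
open import Relation.Binary.PropositionalEquality using (_≡_)

Odd : ℤ → Set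
Odd n = ¬ (+ 2 ∣ n)

_≡_[mod_] : ℤ → ℤ → ℤ → Set
a ≡ b [mod m ] = m ∣ (a ℤ.- b)

Σℚ : ∀ {n} → (Fin n → ℚ) → ℚ
Σℚ {ℕ.zero} f = ℚ.0ℚ
Σℚ {ℕ.suc n} f = f zero ℚ.+ Σℚ (λ i → f (suc i))

_⁴ : ℚ → ℚ
x ⁴ = x ℚ.* x ℚ.* x ℚ.* x

IsLeastR : ℤ → ℤ → ℕ → ℤ → Set
IsLeastR B D β R =
  (+ 0 ℤ.< R) × ((D ℤ.* R) ≡ (+ (2 ℕ.^ (4 ℕ.∸ β)) ℤ.* B) [mod + 16 ]) ×
  (∀ (S : ℤ) → + 0 ℤ.< S → (D ℤ.* S) ≡ (+ (2 ℕ.^ (4 ℕ.∸ β)) ℤ.* B) [mod + 16 ] → R ℤ.≤ S)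

-- The rational number B / (2^β · D); by convention 0 when D = 0 (never used:
-- D is odd in the statement).
frac : ℤ → ℕ → ℤ → ℚ
frac B β (+ ℕ.zero) = ℚ.0ℚ
frac B β (+ (ℕ.suc d)) = B ℚ./ (2 ℕ.^ β ℕ.* ℕ.suc d)
  where instance _ = ℕₚ.m*n≢0 (2 ℕ.^ β) (ℕ.suc d) {{ℕₚ.m^n≢0 2 β}}
frac B β ℤ.-[1+ d ] = (ℤ.- B) ℚ./ (2 ℕ.^ β ℕ.* ℕ.suc d)
  where instance _ = ℕₚ.m*n≢0 (2 ℕ.^ β) (ℕ.suc d) {{ℕₚ.m^n≢0 2 β}}

-- Clearing denominators turns a representation into integers a₁ … a_N and M > 0
-- with 2^β D Σ aᵢ⁴ = B M⁴. A fourth power is 0 or 1 mod 16 according to its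
-- parity. M is even, since otherwise the left side is even and the right side
-- odd. If every aᵢ is even we halve all of them and M, and descend. Otherwise
-- Σ aᵢ⁴ ≡ t (mod 16), where 1 ≤ t ≤ N is the number of odd aᵢ, and writing
-- M = 2h gives D t ≡ 2^(4-β) B h⁴ (mod 16). For odd h this says R ≤ t ≤ N; for
-- even h it says 16 ∣ t, which is impossible for 1 ≤ t ≤ 15.
module Submission where

open import Defs
open import Data.Empty using (⊥-elim)
open import Data.Sum using (_⊎_; inj₁; inj₂; [_,_]′)
open import Data.Product using (∃; ∃-syntax; _×_; _,_)
open import Data.Fin using (Fin; zero; suc)
open import Data.Nat as ℕ using (ℕ; zero; suc; s≤s; z≤n)
import Data.Nat.Properties as ℕₚ
open import Data.Nat.Divisibility as ℕ∣ using (_∣?_)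
open import Data.Nat.Induction using (<-wellFounded)
open import Data.Nat.Primality using (euclidsLemma; prime[2])
open import Data.Integer as ℤ using (ℤ; +_; -[1+_]; _+_; _*_; _-_; ∣_∣)
import Data.Integer.Properties as ℤₚ
open import Data.Integer.DivMod using (a≡a%n+[a/n]*n; n%d<d)
open import Data.Integer.Divisibility using (_∣_)
import Data.Integer.Divisibility.Signed as Signed
open import Data.Integer.GCD using (gcd)
open import Data.Integer.Tactic.RingSolver using (solve-∀)
open import Data.Rational as ℚ using (ℚ; ↥_; ↧_; ↧ₙ_)
import Data.Rational.Properties as ℚₚ
open import Data.Rational.Literals using (fromℤ)
open import Data.Rational.Unnormalised.Base as ℚᵘ using (mkℚᵘ; *≡*)
import Data.Rational.Unnormalised.Properties as ℚᵘₚ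
open import Data.Rational.Solver using (module +-*-Solver)
open import Algebra.Bundles using (CommutativeMonoid)
import Algebra.Properties.CommutativeSemigroup as CommSemigroupProperties
open import Function.Base using (_∘_; case_of_)
open import Induction.WellFounded using (Acc; acc)
open import Relation.Binary.Bundles using (Setoid)
import Relation.Binary.Reasoning.Setoid as SetoidReasoning
open import Relation.Nullary using (¬_; yes; no)
open import Relation.Binary.PropositionalEquality

_⁴ᶻ : ℤ → ℤ
z ⁴ᶻ = z * z * z * z

Σ⁴ : ∀ {n} → (Fin n → ℤ) → ℤ
Σ⁴ {zero}  a = + 0
Σ⁴ {suc n} a = a zero ⁴ᶻ + Σ⁴ (λ i → a (suc i))

-- The ring solver treats `_⁴ᶻ` as an atom, so identities involving it are
-- handed to it in expanded form.
[c*2]⁴≡16*c⁴ : ∀ c → (c * + 2) ⁴ᶻ ≡ + 16 * c ⁴ᶻ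
[c*2]⁴≡16*c⁴ = expanded
  where
  expanded : ∀ c → (c * + 2) * (c * + 2) * (c * + 2) * (c * + 2) ≡ + 16 * (c * c * c * c)
  expanded = solve-∀

+[h*2]⁴≡16*h⁴ : ∀ h → (+ (h ℕ.* 2)) ⁴ᶻ ≡ + 16 * (+ h) ⁴ᶻ
+[h*2]⁴≡16*h⁴ h = trans (cong _⁴ᶻ (ℤₚ.pos-* h 2)) ([c*2]⁴≡16*c⁴ (+ h))

-- `_≡_[mod_]` unfolds to a divisibility of absolute values, from which Agda
-- cannot infer its arguments; calculations use this record version instead.
infix 4 _≈_[mod_]
record _≈_[mod_] (a b m : ℤ) : Set where
  constructor ≈-mod
  field
    divides : m Signed.∣ (a - b)

≈⇒≡-mod : ∀ {a b m} → a ≈ b [mod m ] → a ≡ b [mod m ]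
≈⇒≡-mod (≈-mod m∣a-b) = Signed.∣⇒∣ᵤ m∣a-b

module _ {m : ℤ} where

  ≈-mod-reflexive : ∀ {a b} → a ≡ b → a ≈ b [mod m ]
  ≈-mod-reflexive {a} refl = ≈-mod (Signed.divides (+ 0) (ℤₚ.+-inverseʳ a))

  ≈-mod-sym : ∀ {a b} → a ≈ b [mod m ] → b ≈ a [mod m ]
  ≈-mod-sym {a} {b} (≈-mod m∣a-b) = ≈-mod (subst (m Signed.∣_) (negate a b) (Signed.∣m⇒∣-m m∣a-b))
    where
    negate : ∀ a b → ℤ.- (a - b) ≡ b - a
    negate = solve-∀

  ≈-mod-trans : ∀ {a b c} → a ≈ b [mod m ] → b ≈ c [mod m ] → a ≈ c [mod m ]
  ≈-mod-trans {a} {b} {c} (≈-mod m∣a-b) (≈-mod m∣b-c) =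
    ≈-mod (subst (m Signed.∣_) (telescope a b c) (Signed.∣m∣n⇒∣m+n m∣a-b m∣b-c))
    where
    telescope : ∀ a b c → (a - b) + (b - c) ≡ a - c
    telescope = solve-∀

  ≈-mod-+ : ∀ {a b c d} → a ≈ b [mod m ] → c ≈ d [mod m ] → a + c ≈ b + d [mod m ]
  ≈-mod-+ {a} {b} {c} {d} (≈-mod m∣a-b) (≈-mod m∣c-d) =
    ≈-mod (subst (m Signed.∣_) (regroup a b c d) (Signed.∣m∣n⇒∣m+n m∣a-b m∣c-d))
    where
    regroup : ∀ a b c d → (a - b) + (c - d) ≡ (a + c) - (b + d)
    regroup = solve-∀

  ≈-mod-*ˡ : ∀ c {a b} → a ≈ b [mod m ] → c * a ≈ c * b [mod m ]
  ≈-mod-*ˡ c {a} {b} (≈-mod m∣a-b) =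
    ≈-mod (subst (m Signed.∣_) (distrib c a b) (Signed.∣n⇒∣m*n c m∣a-b))
    where
    distrib : ∀ c a b → c * (a - b) ≡ c * a - c * b
    distrib = solve-∀

  m*k≈0 : ∀ k → m * k ≈ + 0 [mod m ]
  m*k≈0 k = ≈-mod (Signed.divides k (trans (ℤₚ.+-identityʳ (m * k)) (ℤₚ.*-comm m k)))

≈-mod-setoid : ℤ → Setoid _ _
≈-mod-setoid m = record
  { _≈_           = _≈_[mod m ]
  ; isEquivalence = record
    { refl  = ≈-mod-reflexive refl
    ; sym   = ≈-mod-sym
    ; trans = ≈-mod-trans
    }
  }

module ≈-mod-Reasoning (m : ℤ) = SetoidReasoning (≈-mod-setoid m)

odd-* : ∀ a b → Odd a → Odd b → Odd (a * b)
odd-* a b a-odd b-odd 2∣ab =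
  [ a-odd , b-odd ]′ (euclidsLemma ∣ a ∣ ∣ b ∣ prime[2] (subst (2 ℕ∣.∣_) (ℤₚ.abs-* a b) 2∣ab))

odd-⁴ : ∀ a → Odd a → Odd (a ⁴ᶻ)
odd-⁴ a a-odd = odd-* (a * a * a) a (odd-* (a * a) a (odd-* a a a-odd a-odd) a-odd) a-odd

[1+4k]⁴≈1 : ∀ k → (+ 1 + k * + 4) ⁴ᶻ ≈ + 1 [mod + 16 ]
[1+4k]⁴≈1 k = ≈-mod (Signed.divides (k + + 6 * k * k + + 16 * k * k * k + + 16 * k * k * k * k) (expand k))
  where
  expand : ∀ k → let x = + 1 + k * + 4 in
           x * x * x * x - + 1 ≡ (k + + 6 * k * k + + 16 * k * k * k + + 16 * k * k * k * k) * + 16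
  expand = solve-∀

[3+4k]⁴≈1 : ∀ k → (+ 3 + k * + 4) ⁴ᶻ ≈ + 1 [mod + 16 ]
[3+4k]⁴≈1 k = ≈-mod (Signed.divides (+ 5 + + 27 * k + + 54 * k * k + + 48 * k * k * k + + 16 * k * k * k * k) (expand k))
  where
  expand : ∀ k → let x = + 3 + k * + 4 in
           x * x * x * x - + 1 ≡ (+ 5 + + 27 * k + + 54 * k * k + + 48 * k * k * k + + 16 * k * k * k * k) * + 16
  expand = solve-∀

¬odd[c*2] : ∀ c → ¬ Odd (c * + 2)
¬odd[c*2] c c*2-odd = c*2-odd (Signed.∣⇒∣ᵤ {+ 2} (Signed.divides c refl))

odd⇒⁴≈1 : ∀ a → Odd a → a ⁴ᶻ ≈ + 1 [mod + 16 ]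
odd⇒⁴≈1 a a-odd with a ℤ.% + 4 | a≡a%n+[a/n]*n a (+ 4) | n%d<d a (+ 4)
... | 0 | a≡0+4k | _ = ⊥-elim (¬odd[c*2] (a ℤ./ + 4 * + 2) (subst Odd (trans a≡0+4k (regroup (a ℤ./ + 4))) a-odd))
  where
  regroup : ∀ k → + 0 + k * + 4 ≡ k * + 2 * + 2
  regroup = solve-∀
... | 1 | a≡1+4k | _ = subst (λ x → x ⁴ᶻ ≈ + 1 [mod + 16 ]) (sym a≡1+4k) ([1+4k]⁴≈1 (a ℤ./ + 4))
... | 2 | a≡2+4k | _ = ⊥-elim (¬odd[c*2] (+ 1 + a ℤ./ + 4 * + 2) (subst Odd (trans a≡2+4k (regroup (a ℤ./ + 4))) a-odd))
  where
  regroup : ∀ k → + 2 + k * + 4 ≡ (+ 1 + k * + 2) * + 2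
  regroup = solve-∀
... | 3 | a≡3+4k | _ = subst (λ x → x ⁴ᶻ ≈ + 1 [mod + 16 ]) (sym a≡3+4k) ([3+4k]⁴≈1 (a ℤ./ + 4))
... | suc (suc (suc (suc _))) | _ | s≤s (s≤s (s≤s (s≤s ())))

even⇒⁴≡16*c⁴ : ∀ a → + 2 ∣ a → ∃[ c ] a ⁴ᶻ ≡ + 16 * c ⁴ᶻ
even⇒⁴≡16*c⁴ a 2∣a with Signed.∣ᵤ⇒∣ {+ 2} {a} 2∣a
... | Signed.divides c a≡c*2 = c , trans (cong _⁴ᶻ a≡c*2) ([c*2]⁴≡16*c⁴ c)

-- Odd numbers are units modulo 16, with inverse their cube.
odd*x≈0⇒x≈0 : ∀ d x → Odd d → d * x ≈ + 0 [mod + 16 ] → x ≈ + 0 [mod + 16 ]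
odd*x≈0⇒x≈0 d x d-odd dx≈0 = begin
  x                   ≡⟨ ℤₚ.*-identityʳ x ⟨
  x * + 1             ≈⟨ ≈-mod-*ˡ x (≈-mod-sym (odd⇒⁴≈1 d d-odd)) ⟩
  x * (d * d * d * d) ≡⟨ regroup x d ⟩
  d * d * d * (d * x) ≈⟨ ≈-mod-*ˡ (d * d * d) dx≈0 ⟩
  d * d * d * + 0     ≡⟨ ℤₚ.*-zeroʳ (d * d * d) ⟩
  + 0                 ∎
  where
  open ≈-mod-Reasoning (+ 16)
  regroup : ∀ x d → x * (d * d * d * d) ≡ d * d * d * (d * x)
  regroup = solve-∀

Σ⁴-mod-16 : ∀ {N} (a : Fin N → ℤ) →
  (∃ λ (b : Fin N → ℤ) → Σ⁴ a ≡ + 16 * Σ⁴ b) ⊎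
  (∃[ t ] 1 ℕ.≤ t × t ℕ.≤ N × Σ⁴ a ≈ + t [mod + 16 ])
Σ⁴-mod-16 {zero} a = inj₁ (a , refl)
Σ⁴-mod-16 {suc N} a with 2 ∣? ∣ a zero ∣ | Σ⁴-mod-16 (λ i → a (suc i))
... | yes 2∣a₀ | inj₁ (b , Σ≡16Σb) with even⇒⁴≡16*c⁴ (a zero) 2∣a₀
...   | c , a₀⁴≡16c⁴ =
  inj₁ (b′ , trans (cong₂ _+_ a₀⁴≡16c⁴ Σ≡16Σb) (sym (ℤₚ.*-distribˡ-+ (+ 16) (c ⁴ᶻ) (Σ⁴ b))))
  where
  b′ : Fin (suc N) → ℤ
  b′ zero    = c
  b′ (suc i) = b i
Σ⁴-mod-16 {suc N} a | yes 2∣a₀ | inj₂ (t , 1≤t , t≤N , Σ≈t) with even⇒⁴≡16*c⁴ (a zero) 2∣a₀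
...   | c , a₀⁴≡16c⁴ = inj₂ (t , 1≤t , ℕₚ.m≤n⇒m≤1+n t≤N , ≈-mod-+ a₀⁴≈0 Σ≈t)
  where
  a₀⁴≈0 = ≈-mod-trans (≈-mod-reflexive a₀⁴≡16c⁴) (m*k≈0 (c ⁴ᶻ))
Σ⁴-mod-16 {suc N} a | no a₀-odd | inj₁ (b , Σ≡16Σb) =
  inj₂ (1 , ℕₚ.≤-refl , s≤s z≤n , ≈-mod-+ (odd⇒⁴≈1 (a zero) a₀-odd) Σ≈0)
  where
  Σ≈0 = ≈-mod-trans (≈-mod-reflexive Σ≡16Σb) (m*k≈0 (Σ⁴ b))
Σ⁴-mod-16 {suc N} a | no a₀-odd | inj₂ (t , 1≤t , t≤N , Σ≈t) =
  inj₂ (suc t , s≤s z≤n , s≤s t≤N , ≈-mod-+ (odd⇒⁴≈1 (a zero) a₀-odd) Σ≈t)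

1≤t≤15⇒t≉0 : ∀ {t} → 1 ℕ.≤ t → t ℕ.≤ 15 → ¬ (+ t ≈ + 0 [mod + 16 ])
1≤t≤15⇒t≉0 {t} 1≤t t≤15 t≈0 = ℕₚ.<⇒≱ (s≤s t≤15) (ℕ∣.∣⇒≤ {{ℕ.>-nonZero 1≤t}} 16∣t)
  where
  16∣t : 16 ℕ∣.∣ t
  16∣t = subst (16 ℕ∣.∣_) (ℕₚ.+-identityʳ t) (≈⇒≡-mod t≈0)

module Descent (P Q : ℤ) (PQ≡16 : P * Q ≡ + 16) (2∣P : + 2 ∣ P)
               {B D : ℤ} (B-odd : Odd B) (D-odd : Odd D) {N : ℕ} (N≤15 : N ℕ.≤ 15) where

  instance
    P≢0 : ℤ.NonZero P
    P≢0 = ℤ.≢-nonZero {P} λ P≡0 → case trans (cong (_* Q) (sym P≡0)) PQ≡16 of λ ()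

  Solution : ℕ → Set
  Solution M = ∃ λ (a : Fin N → ℤ) → P * D * Σ⁴ a ≡ B * (+ M) ⁴ᶻ

  SmallRoot : Set
  SmallRoot = ∃[ t ] 1 ℕ.≤ t × t ℕ.≤ N × D * + t ≈ Q * B [mod + 16 ]

  odd-denominator-impossible : ∀ {M} → Odd (+ M) → ¬ Solution M
  odd-denominator-impossible {M} M-odd (a , eq) =
    odd-* B ((+ M) ⁴ᶻ) B-odd (odd-⁴ (+ M) M-odd) (subst (+ 2 ∣_) eq 2∣PDΣ)
    where
    2∣PDΣ : + 2 ∣ P * D * Σ⁴ a
    2∣PDΣ = Signed.∣⇒∣ᵤ (Signed.∣m⇒∣m*n (Σ⁴ a) (Signed.∣m⇒∣m*n D (Signed.∣ᵤ⇒∣ {+ 2} {P} 2∣P)))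

  halve-solution : ∀ h (a b : Fin N → ℤ) → Σ⁴ a ≡ + 16 * Σ⁴ b →
          P * D * Σ⁴ a ≡ B * (+ (h ℕ.* 2)) ⁴ᶻ → P * D * Σ⁴ b ≡ B * (+ h) ⁴ᶻ
  halve-solution h a b Σa≡16Σb eq = ℤₚ.*-cancelˡ-≡ (+ 16) _ _ (begin
    + 16 * (P * D * Σ⁴ b)   ≡⟨ x∙yz≈y∙xz (+ 16) (P * D) (Σ⁴ b) ⟩
    P * D * (+ 16 * Σ⁴ b)   ≡⟨ cong (P * D *_) Σa≡16Σb ⟨
    P * D * Σ⁴ a            ≡⟨ eq ⟩
    B * (+ (h ℕ.* 2)) ⁴ᶻ    ≡⟨ cong (B *_) (+[h*2]⁴≡16*h⁴ h) ⟩
    B * (+ 16 * (+ h) ⁴ᶻ)   ≡⟨ x∙yz≈y∙xz B (+ 16) ((+ h) ⁴ᶻ) ⟩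
    + 16 * (B * (+ h) ⁴ᶻ)   ∎)
    where
    open ≡-Reasoning
    open CommSemigroupProperties ℤₚ.*-commutativeSemigroup using (x∙yz≈y∙xz)

  cancel-P : ∀ h (a : Fin N → ℤ) → P * D * Σ⁴ a ≡ B * (+ (h ℕ.* 2)) ⁴ᶻ → D * Σ⁴ a ≡ Q * B * (+ h) ⁴ᶻ
  cancel-P h a eq = ℤₚ.*-cancelˡ-≡ P _ _ (begin
    P * (D * Σ⁴ a)          ≡⟨ ℤₚ.*-assoc P D (Σ⁴ a) ⟨
    P * D * Σ⁴ a            ≡⟨ eq ⟩
    B * (+ (h ℕ.* 2)) ⁴ᶻ    ≡⟨ cong (B *_) (+[h*2]⁴≡16*h⁴ h) ⟩
    B * (+ 16 * H)          ≡⟨ cong (λ c → B * (c * H)) PQ≡16 ⟨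
    B * (P * Q * H)         ≡⟨ rearrange B P Q H ⟩
    P * (Q * B * H)         ∎)
    where
    open ≡-Reasoning
    H = (+ h) ⁴ᶻ
    rearrange : ∀ B P Q H → B * (P * Q * H) ≡ P * (Q * B * H)
    rearrange = solve-∀

  primitive⇒root : ∀ h (a : Fin N → ℤ) → P * D * Σ⁴ a ≡ B * (+ (h ℕ.* 2)) ⁴ᶻ →
              ∀ {t} → 1 ℕ.≤ t → t ℕ.≤ N → Σ⁴ a ≈ + t [mod + 16 ] → D * + t ≈ Q * B [mod + 16 ]
  primitive⇒root h a eq {t} 1≤t t≤N Σ≈t with 2 ∣? h
  ... | no h-odd = begin
    D * + t             ≈⟨ Dt≈QBh⁴ ⟩
    Q * B * (+ h) ⁴ᶻ    ≈⟨ ≈-mod-*ˡ (Q * B) (odd⇒⁴≈1 (+ h) h-odd) ⟩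
    Q * B * + 1         ≡⟨ ℤₚ.*-identityʳ (Q * B) ⟩
    Q * B               ∎
    where
    open ≈-mod-Reasoning (+ 16)
    Dt≈QBh⁴ = ≈-mod-trans (≈-mod-*ˡ D (≈-mod-sym Σ≈t)) (≈-mod-reflexive (cancel-P h a eq))
  ... | yes (ℕ∣.divides g refl) =
    ⊥-elim (1≤t≤15⇒t≉0 1≤t (ℕₚ.≤-trans t≤N N≤15) (odd*x≈0⇒x≈0 D (+ t) D-odd Dt≈0))
    where
    open ≈-mod-Reasoning (+ 16)
    open CommSemigroupProperties ℤₚ.*-commutativeSemigroup using (x∙yz≈y∙xz)
    Dt≈0 : D * + t ≈ + 0 [mod + 16 ]
    Dt≈0 = begin
      D * + t                      ≈⟨ ≈-mod-*ˡ D (≈-mod-sym Σ≈t) ⟩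
      D * Σ⁴ a                     ≡⟨ cancel-P (g ℕ.* 2) a eq ⟩
      Q * B * (+ (g ℕ.* 2)) ⁴ᶻ     ≡⟨ cong (Q * B *_) (+[h*2]⁴≡16*h⁴ g) ⟩
      Q * B * (+ 16 * (+ g) ⁴ᶻ)    ≡⟨ x∙yz≈y∙xz (Q * B) (+ 16) ((+ g) ⁴ᶻ) ⟩
      + 16 * (Q * B * (+ g) ⁴ᶻ)    ≈⟨ m*k≈0 (Q * B * (+ g) ⁴ᶻ) ⟩
      + 0                          ∎

  descent : ∀ {M} → Acc ℕ._<_ M → .{{ℕ.NonZero M}} → Solution M → SmallRoot
  descent {M} (acc rec) (a , eq) with 2 ∣? M
  ... | no M-odd = ⊥-elim (odd-denominator-impossible M-odd (a , eq))
  ... | yes (ℕ∣.divides h refl) with Σ⁴-mod-16 a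
  ...   | inj₁ (b , Σa≡16Σb) = descent (rec h<M) {{h≢0}} (b , halve-solution h a b Σa≡16Σb eq)
    where
    h≢0 = ℕₚ.m*n≢0⇒m≢0 h
    h<M = ℕₚ.m<m*n h 2 {{h≢0}} (ℕₚ.n<1+n 1)
  ...   | inj₂ (t , 1≤t , t≤N , Σa≈t) = t , 1≤t , t≤N , primitive⇒root h a eq 1≤t t≤N Σa≈t

fromℤ-injective : ∀ {a b} → fromℤ a ≡ fromℤ b → a ≡ b
fromℤ-injective = cong ↥_

fromℤ-* : ∀ a b → fromℤ (a * b) ≡ fromℤ a ℚ.* fromℤ b
fromℤ-* a b = ℚₚ.toℚᵘ-injective
  (ℚᵘₚ.≃-sym (ℚᵘₚ.≃-trans (ℚₚ.toℚᵘ-homo-* (fromℤ a) (fromℤ b)) (*≡* refl)))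

fromℤ-+ : ∀ a b → fromℤ (a + b) ≡ fromℤ a ℚ.+ fromℤ b
fromℤ-+ a b = ℚₚ.toℚᵘ-injective
  (ℚᵘₚ.≃-sym (ℚᵘₚ.≃-trans (ℚₚ.toℚᵘ-homo-+ (fromℤ a) (fromℤ b)) (*≡* (cross a b))))
  where
  cross : ∀ a b → (a * + 1 + b * + 1) * + 1 ≡ (a + b) * + 1
  cross = solve-∀

fromℤ-⁴ : ∀ a → fromℤ (a ⁴ᶻ) ≡ fromℤ a ⁴
fromℤ-⁴ a = begin
  fromℤ (a * a * a * a)                  ≡⟨ fromℤ-* (a * a * a) a ⟩
  fromℤ (a * a * a) ℚ.* fromℤ a          ≡⟨ cong (ℚ._* fromℤ a) (fromℤ-* (a * a) a) ⟩
  fromℤ (a * a) ℚ.* fromℤ a ℚ.* fromℤ a  ≡⟨ cong (λ y → y ℚ.* fromℤ a ℚ.* fromℤ a) (fromℤ-* a a) ⟩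
  fromℤ a ⁴                              ∎
  where open ≡-Reasoning

⁴-distrib-* : ∀ x y → (x ℚ.* y) ⁴ ≡ x ⁴ ℚ.* y ⁴
⁴-distrib-* = solve 2 (λ x y → (x :* y) :* (x :* y) :* (x :* y) :* (x :* y)
                             := (x :* x :* x :* x) :* (y :* y :* y :* y)) refl
  where open +-*-Solver

d*[n/d]≡n : ∀ n d .{{_ : ℕ.NonZero d}} → fromℤ (+ d) ℚ.* (n ℚ./ d) ≡ fromℤ n
d*[n/d]≡n n (suc k) = ℚₚ.toℚᵘ-injective (begin-equality
  ℚ.toℚᵘ (fromℤ (+ suc k) ℚ.* (n ℚ./ suc k))    ≃⟨ ℚₚ.toℚᵘ-homo-* (fromℤ (+ suc k)) (n ℚ./ suc k) ⟩
  mkℚᵘ (+ suc k) 0 ℚᵘ.* ℚ.toℚᵘ (n ℚ./ suc k)    ≃⟨ ℚᵘₚ.*-congˡ {mkℚᵘ (+ suc k) 0} (ℚₚ.toℚᵘ-fromℚᵘ (mkℚᵘ n k)) ⟩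
  mkℚᵘ (+ suc k) 0 ℚᵘ.* mkℚᵘ n k               ≃⟨ *≡* cross ⟩
  ℚ.toℚᵘ (fromℤ n)                              ∎)
  where
  open ℚᵘₚ.≤-Reasoning
  cancel : ∀ n d → (d * n) * + 1 ≡ n * d
  cancel = solve-∀
  cross : (+ suc k * n) * + 1 ≡ n * + (1 ℕ.* suc k)
  cross = trans (cancel n (+ suc k)) (cong (λ e → n * + suc e) (sym (ℕₚ.+-identityʳ k)))

p*↧p≡↥p : ∀ p → p ℚ.* fromℤ (↧ p) ≡ fromℤ (↥ p)
p*↧p≡↥p p = begin
  p ℚ.* fromℤ (↧ p)                   ≡⟨ ℚₚ.*-comm p (fromℤ (↧ p)) ⟩
  fromℤ (↧ p) ℚ.* p                   ≡⟨ cong (fromℤ (↧ p) ℚ.*_) (ℚₚ.↥p/↧p≡p p) ⟨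
  fromℤ (↧ p) ℚ.* (↥ p ℚ./ ↧ₙ p)      ≡⟨ d*[n/d]≡n (↥ p) (↧ₙ p) ⟩
  fromℤ (↥ p)                         ∎
  where open ≡-Reasoning

common-denominator : ∀ {N} (x : Fin N → ℚ) →
  ∃[ M ] ℕ.NonZero M × ∃ λ (a : Fin N → ℤ) → ∀ i → x i ℚ.* fromℤ (+ M) ≡ fromℤ (a i)
common-denominator {zero} x = 1 , _ , (λ ()) , (λ ())
common-denominator {suc N} x with common-denominator (λ i → x (suc i))
... | M , M≢0 , a , xM≡a = ↧ₙ x₀ ℕ.* M , ℕₚ.m*n≢0 (↧ₙ x₀) M {{_}} {{M≢0}} , a′ , xdM≡a′
  where
  x₀ = x zero
  d  = ↧ x₀
  a′ : Fin (suc N) → ℤ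
  a′ zero    = ↥ x₀ * + M
  a′ (suc i) = a i * d
  dM≡d*M : fromℤ (+ (↧ₙ x₀ ℕ.* M)) ≡ fromℤ d ℚ.* fromℤ (+ M)
  dM≡d*M = trans (cong fromℤ (ℤₚ.pos-* (↧ₙ x₀) M)) (fromℤ-* d (+ M))
  xdM≡a′ : ∀ i → x i ℚ.* fromℤ (+ (↧ₙ x₀ ℕ.* M)) ≡ fromℤ (a′ i)
  xdM≡a′ zero = begin
    x₀ ℚ.* fromℤ (+ (↧ₙ x₀ ℕ.* M))        ≡⟨ cong (x₀ ℚ.*_) dM≡d*M ⟩
    x₀ ℚ.* (fromℤ d ℚ.* fromℤ (+ M))      ≡⟨ ℚₚ.*-assoc x₀ (fromℤ d) (fromℤ (+ M)) ⟨
    x₀ ℚ.* fromℤ d ℚ.* fromℤ (+ M)        ≡⟨ cong (ℚ._* fromℤ (+ M)) (p*↧p≡↥p x₀) ⟩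
    fromℤ (↥ x₀) ℚ.* fromℤ (+ M)          ≡⟨ fromℤ-* (↥ x₀) (+ M) ⟨
    fromℤ (↥ x₀ * + M)                    ∎
    where open ≡-Reasoning
  xdM≡a′ (suc i) = begin
    x (suc i) ℚ.* fromℤ (+ (↧ₙ x₀ ℕ.* M))      ≡⟨ cong (x (suc i) ℚ.*_) dM≡d*M ⟩
    x (suc i) ℚ.* (fromℤ d ℚ.* fromℤ (+ M))    ≡⟨ x∙yz≈xz∙y (x (suc i)) (fromℤ d) (fromℤ (+ M)) ⟩
    x (suc i) ℚ.* fromℤ (+ M) ℚ.* fromℤ d      ≡⟨ cong (ℚ._* fromℤ d) (xM≡a i) ⟩
    fromℤ (a i) ℚ.* fromℤ d                    ≡⟨ fromℤ-* (a i) d ⟨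
    fromℤ (a i * d)                            ∎
    where
    open ≡-Reasoning
    open CommSemigroupProperties (CommutativeMonoid.commutativeSemigroup ℚₚ.*-1-commutativeMonoid)
      using (x∙yz≈xz∙y)

Σℚ⁴*c⁴≡Σ⁴ : ∀ {N} (x : Fin N → ℚ) c (a : Fin N → ℤ) →
          (∀ i → x i ℚ.* c ≡ fromℤ (a i)) → Σℚ (λ i → x i ⁴) ℚ.* c ⁴ ≡ fromℤ (Σ⁴ a)
Σℚ⁴*c⁴≡Σ⁴ {zero}  x c a xc≡a = ℚₚ.*-zeroˡ (c ⁴)
Σℚ⁴*c⁴≡Σ⁴ {suc N} x c a xc≡a = begin
  (x zero ⁴ ℚ.+ S) ℚ.* c ⁴                      ≡⟨ ℚₚ.*-distribʳ-+ (c ⁴) (x zero ⁴) S ⟩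
  x zero ⁴ ℚ.* c ⁴ ℚ.+ S ℚ.* c ⁴                ≡⟨ cong₂ ℚ._+_ head tail ⟩
  fromℤ (a zero ⁴ᶻ) ℚ.+ fromℤ (Σ⁴ (a ∘ suc))    ≡⟨ fromℤ-+ (a zero ⁴ᶻ) (Σ⁴ (a ∘ suc)) ⟨
  fromℤ (Σ⁴ a)                                  ∎
  where
  open ≡-Reasoning
  S = Σℚ (λ i → x (suc i) ⁴)
  tail : S ℚ.* c ⁴ ≡ fromℤ (Σ⁴ (a ∘ suc))
  tail = Σℚ⁴*c⁴≡Σ⁴ (x ∘ suc) c (a ∘ suc) (xc≡a ∘ suc)
  head : x zero ⁴ ℚ.* c ⁴ ≡ fromℤ (a zero ⁴ᶻ)
  head = begin
    x zero ⁴ ℚ.* c ⁴   ≡⟨ ⁴-distrib-* (x zero) c ⟨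
    (x zero ℚ.* c) ⁴   ≡⟨ cong _⁴ (xc≡a zero) ⟩
    fromℤ (a zero) ⁴   ≡⟨ fromℤ-⁴ (a zero) ⟨
    fromℤ (a zero ⁴ᶻ)  ∎

2^β*D*frac≡B : ∀ β B D → Odd D → fromℤ (+ (2 ℕ.^ β) * D) ℚ.* frac B β D ≡ fromℤ B
2^β*D*frac≡B β B (+ zero) D-odd = ⊥-elim (D-odd (ℕ∣._∣0 2))
2^β*D*frac≡B β B (+ suc d) D-odd = begin
  fromℤ (+ (2 ℕ.^ β) * + suc d) ℚ.* (B ℚ./ K)  ≡⟨ cong (λ z → fromℤ z ℚ.* (B ℚ./ K)) (ℤₚ.pos-* (2 ℕ.^ β) (suc d)) ⟨
  fromℤ (+ K) ℚ.* (B ℚ./ K)                    ≡⟨ d*[n/d]≡n B K ⟩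
  fromℤ B                                      ∎
  where
  open ≡-Reasoning
  K = 2 ℕ.^ β ℕ.* suc d
  instance _ = ℕₚ.m*n≢0 (2 ℕ.^ β) (suc d) {{ℕₚ.m^n≢0 2 β}}
2^β*D*frac≡B β B -[1+ d ] D-odd = begin
  fromℤ (+ (2 ℕ.^ β) * -[1+ d ]) ℚ.* -B/K    ≡⟨ cong (λ z → fromℤ z ℚ.* -B/K) 2^β*-[1+d]≡-1*K ⟩
  fromℤ (ℤ.-1ℤ * + K) ℚ.* -B/K               ≡⟨ cong (ℚ._* -B/K) (fromℤ-* ℤ.-1ℤ (+ K)) ⟩
  fromℤ ℤ.-1ℤ ℚ.* fromℤ (+ K) ℚ.* -B/K       ≡⟨ ℚₚ.*-assoc (fromℤ ℤ.-1ℤ) (fromℤ (+ K)) -B/K ⟩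
  fromℤ ℤ.-1ℤ ℚ.* (fromℤ (+ K) ℚ.* -B/K)     ≡⟨ cong (fromℤ ℤ.-1ℤ ℚ.*_) (d*[n/d]≡n (ℤ.- B) K) ⟩
  fromℤ ℤ.-1ℤ ℚ.* fromℤ (ℤ.- B)              ≡⟨ fromℤ-* ℤ.-1ℤ (ℤ.- B) ⟨
  fromℤ (ℤ.-1ℤ * ℤ.- B)                      ≡⟨ cong fromℤ (trans (ℤₚ.-1*i≡-i (ℤ.- B)) (ℤₚ.neg-involutive B)) ⟩
  fromℤ B                                    ∎
  where
  open ≡-Reasoning
  K = 2 ℕ.^ β ℕ.* suc d
  instance _ = ℕₚ.m*n≢0 (2 ℕ.^ β) (suc d) {{ℕₚ.m^n≢0 2 β}}
  -B/K = (ℤ.- B) ℚ./ K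
  2^β*-[1+d]≡-1*K : + (2 ℕ.^ β) * -[1+ d ] ≡ ℤ.-1ℤ * + K
  2^β*-[1+d]≡-1*K = begin
    + (2 ℕ.^ β) * ℤ.- + suc d      ≡⟨ ℤₚ.neg-distribʳ-* (+ (2 ℕ.^ β)) (+ suc d) ⟨
    ℤ.- (+ (2 ℕ.^ β) * + suc d)    ≡⟨ cong ℤ.-_ (ℤₚ.pos-* (2 ℕ.^ β) (suc d)) ⟨
    ℤ.- + K                        ≡⟨ ℤₚ.-1*i≡-i (+ K) ⟨
    ℤ.-1ℤ * + K                    ∎

clear-denominators : ∀ β B D {N} (x : Fin N → ℚ) → Odd D → Σℚ (λ i → x i ⁴) ≡ frac B β D →
  ∃[ M ] ℕ.NonZero M × ∃ λ (a : Fin N → ℤ) → + (2 ℕ.^ β) * D * Σ⁴ a ≡ B * (+ M) ⁴ᶻ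
clear-denominators β B D x D-odd Σx⁴≡frac with common-denominator x
... | M , M≢0 , a , xM≡a = M , M≢0 , a , fromℤ-injective (begin
  fromℤ (P * D * Σ⁴ a)                   ≡⟨ fromℤ-* (P * D) (Σ⁴ a) ⟩
  fromℤ (P * D) ℚ.* fromℤ (Σ⁴ a)         ≡⟨ cong (fromℤ (P * D) ℚ.*_) (Σℚ⁴*c⁴≡Σ⁴ x (fromℤ (+ M)) a xM≡a) ⟨
  fromℤ (P * D) ℚ.* (S ℚ.* M′ ⁴)         ≡⟨ ℚₚ.*-assoc (fromℤ (P * D)) S (M′ ⁴) ⟨
  fromℤ (P * D) ℚ.* S ℚ.* M′ ⁴           ≡⟨ cong (λ s → fromℤ (P * D) ℚ.* s ℚ.* M′ ⁴) Σx⁴≡frac ⟩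
  fromℤ (P * D) ℚ.* frac B β D ℚ.* M′ ⁴  ≡⟨ cong (ℚ._* M′ ⁴) (2^β*D*frac≡B β B D D-odd) ⟩
  fromℤ B ℚ.* M′ ⁴                       ≡⟨ cong (fromℤ B ℚ.*_) (fromℤ-⁴ (+ M)) ⟨
  fromℤ B ℚ.* fromℤ ((+ M) ⁴ᶻ)           ≡⟨ fromℤ-* B ((+ M) ⁴ᶻ) ⟨
  fromℤ (B * (+ M) ⁴ᶻ)                   ∎)
  where
  open ≡-Reasoning
  P  = + (2 ℕ.^ β)
  S  = Σℚ (λ i → x i ⁴)
  M′ = fromℤ (+ M)

2^β*2^[4∸β]≡16 : ∀ {β} → β ℕ.≤ 4 → + (2 ℕ.^ β) * + (2 ℕ.^ (4 ℕ.∸ β)) ≡ + 16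
2^β*2^[4∸β]≡16 {β} β≤4 = begin
  + (2 ℕ.^ β) * + (2 ℕ.^ (4 ℕ.∸ β))    ≡⟨ ℤₚ.pos-* (2 ℕ.^ β) (2 ℕ.^ (4 ℕ.∸ β)) ⟨
  + (2 ℕ.^ β ℕ.* 2 ℕ.^ (4 ℕ.∸ β))      ≡⟨ cong +_ (ℕₚ.^-distribˡ-+-* 2 β (4 ℕ.∸ β)) ⟨
  + (2 ℕ.^ (β ℕ.+ (4 ℕ.∸ β)))          ≡⟨ cong (λ e → + (2 ℕ.^ e)) (ℕₚ.m+[n∸m]≡n β≤4) ⟩
  + 16                                 ∎
  where open ≡-Reasoning

2∣2^β : ∀ {β} → 1 ℕ.≤ β → + 2 ∣ + (2 ℕ.^ β)
2∣2^β {suc β} _ = ℕ∣.m∣m*n (2 ℕ.^ β)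

lemma6p8 : (β : ℕ) → 1 ℕ.≤ β → β ℕ.≤ 4 →
    (B D : ℤ) → Odd B → Odd D → gcd B D ≡ + 1 →
    (R : ℤ) → IsLeastR B D β R →
    (N : ℕ) → 1 ℕ.≤ N → N ℕ.≤ 15 → + N ℤ.< R →
    ¬ (∃ λ (x : Fin N → ℚ) → Σℚ (λ i → x i ⁴) ≡ frac B β D)
lemma6p8 β 1≤β β≤4 B D B-odd D-odd _ R (_ , _ , R-least) N _ N≤15 N<R (x , Σx⁴≡frac)
  with clear-denominators β B D x D-odd Σx⁴≡frac
... | M , M≢0 , solution
  with Descent.descent (+ (2 ℕ.^ β)) (+ (2 ℕ.^ (4 ℕ.∸ β))) (2^β*2^[4∸β]≡16 β≤4) (2∣2^β 1≤β)
         B-odd D-odd N≤15 (<-wellFounded M) {{M≢0}} solution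
... | t , 1≤t , t≤N , Dt≈QB = ℕₚ.<⇒≱ (ℤₚ.drop‿+<+ (ℤₚ.<-≤-trans N<R R≤t)) t≤N
  where
  R≤t : R ℤ.≤ + t
  R≤t = R-least (+ t) (ℤ.+<+ 1≤t) (≈⇒≡-mod Dt≈QB)
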